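{- The logic IvFDE_T is a conservative expansion of both IDM4 and Tm. That is: (a) for every set of formulas Γ ∪ {φ} over the signature {∧, ∨, →, ¬} of IDM4, Γ ⊢_{IvFDE_T} φ iff Γ ⊢_{IDM4} φ; and (b) for every set of formulas Γ ∪ {φ} over the signature {→, ∼, □} of Tm, Γ ⊢_{IvFDE_T} φ iff Γ ⊢_{Tm} φ.
   Context: IDM4 (Pynko's 4-valued expansion of Belnap–Dunn's logic FDE by an implication) is the logic over the signature {∧, ∨, →, ¬} given by the Hilbert calculus with modus ponens and the axiom schemas: (Ax1) φ→(ψ→φ); (Ax2) (φ→(ψ→γ))→((φ→ψ)→(φ→γ)); (Ax3) φ→(ψ→(φ∧ψ)); (Ax4) (φ∧ψ)→φ; (Ax5) (φ∧ψ)→ψ; (Ax6) φ→(φ∨ψ); (Ax7) ψ→(φ∨ψ); (Ax8) (φ→γ)→((ψ→γ)→((φ∨ψ)→γ)); (DN) ¬¬φ↔φ; (DM1) ¬(φ∨ψ)↔(¬φ∧¬ψ); (DM2) ¬(φ∧ψ)↔(¬φ∨¬ψ); (DM3) ¬(φ→ψ)↔(φ∧¬ψ); (AxP) φ∨(φ→ψ); where φ↔ψ abbreviates (φ→ψ)∧(ψ→φ). It is characterized by the 4-valued matrix on pairs (z1,z2) ∈ {0,1}², with designated values those with z1=1, and z∧w=(z1⊓w1, z2⊔w2), z∨w=(z1⊔w1, z2⊓w2), ¬z=(z2,z1), z→w=(z1⇒w1, z1⊓w2). Tm (Ivlev's 4-valued non-normal version of modal logic KT) is the logic over the signature {→, ∼,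 □} (∼ a classical negation) given by the Hilbert calculus with modus ponens and axiom schemas (Ax1), (Ax2), (Ax9) (∼ψ→∼φ)→((∼ψ→φ)→ψ), (K) □(φ→ψ)→(□φ→□ψ), (K1) □(φ→ψ)→(□∼ψ→□∼φ), (K2) □∼(φ→ψ)↔(□φ∧□∼ψ), (M1) (□∼φ∨□ψ)→□(φ→ψ), (T) □φ→φ, (DN1) □φ↔□∼∼φ, where in Tm φ∨ψ abbreviates ∼φ→ψ, φ∧ψ abbreviates ∼(φ→∼ψ), and φ↔ψ abbreviates ∼((φ→ψ)→∼(ψ→φ)). It is characterized by Ivlev's 4-valued non-deterministic matrix. IvFDE_T is the logic over the signature {∧, ∨, →, ¬, ∼, □} given by the Hilbert calculus containing modus ponens, all axiom schemas of IDM4, all axiom schemas of Tm (with ∧ and ∨ now primitive and ↔ abbreviating (φ→ψ)∧(ψ→φ)), plus: (N1) □(φ∧ψ)↔(□φ∧□ψ); (N2) □∼(φ∨ψ)↔□(∼φ∧∼ψ); (N3) (□∼φ∨□∼ψ)→□∼(φ∧ψ); (N4) (□φ∨□ψ)→□(φ∨ψ); (N5) □φ↔□∼¬φ; (N6) □∼φ↔□∼¬¬φ; (N7) □∼(φ∧ψ)→(□φ→□∼ψ); (N8) □∼(φ∧ψ)→(□ψ→□∼φ); (N9) □(φ∨ψ)→(□∼φ→□ψ); (N10) □(φ∨ψ)→(□∼ψ→□φ). It is sound and complete w.r.t. a 6-valued non-deterministic matrix whose truth-values are the tuples (z1,z2,z3,z4) ∈ {0,1}⁴ (representing the values of ξ,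 □ξ, □∼ξ, ¬ξ) with z2 ≤ z1, z1⊓z3=0, z2⊓z4=0, z3 ≤ z4, designated iff z1=1. -}

module Defs where

open import Data.Nat using (ℕ)
open import Data.Product using (Σ; _×_)
open import Relation.Binary.PropositionalEquality using (_≡_)
open import Relation.Unary using (Pred)
open import Level using (0ℓ)

infixr 5 _⇒ᴵ_
infixl 6 _∨ᴵ_
infixl 7 _∧ᴵ_

data FormI : Set where
  varᴵ  : ℕ → FormI
  _∧ᴵ_  : FormI → FormI → FormI
  _∨ᴵ_  : FormI → FormI → FormI
  _⇒ᴵ_  : FormI → FormI → FormI
  ¬ᴵ    : FormI → FormI

_⇔ᴵ_ : FormI → FormI → FormI
φ ⇔ᴵ ψ = (φ ⇒ᴵ ψ) ∧ᴵ (ψ ⇒ᴵ φ)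

data AxIDM4 : FormI → Set where
  ax1 : ∀ φ ψ → AxIDM4 (φ ⇒ᴵ (ψ ⇒ᴵ φ))
  ax2 : ∀ φ ψ γ → AxIDM4 ((φ ⇒ᴵ (ψ ⇒ᴵ γ)) ⇒ᴵ ((φ ⇒ᴵ ψ) ⇒ᴵ (φ ⇒ᴵ γ)))
  ax3 : ∀ φ ψ → AxIDM4 (φ ⇒ᴵ (ψ ⇒ᴵ (φ ∧ᴵ ψ)))
  ax4 : ∀ φ ψ → AxIDM4 ((φ ∧ᴵ ψ) ⇒ᴵ φ)
  ax5 : ∀ φ ψ → AxIDM4 ((φ ∧ᴵ ψ) ⇒ᴵ ψ)
  ax6 : ∀ φ ψ → AxIDM4 (φ ⇒ᴵ (φ ∨ᴵ ψ))
  ax7 : ∀ φ ψ → AxIDM4 (ψ ⇒ᴵ (φ ∨ᴵ ψ))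
  ax8 : ∀ φ ψ γ → AxIDM4 ((φ ⇒ᴵ γ) ⇒ᴵ ((ψ ⇒ᴵ γ) ⇒ᴵ ((φ ∨ᴵ ψ) ⇒ᴵ γ)))
  dn  : ∀ φ → AxIDM4 (¬ᴵ (¬ᴵ φ) ⇔ᴵ φ)
  dm1 : ∀ φ ψ → AxIDM4 (¬ᴵ (φ ∨ᴵ ψ) ⇔ᴵ (¬ᴵ φ ∧ᴵ ¬ᴵ ψ))
  dm2 : ∀ φ ψ → AxIDM4 (¬ᴵ (φ ∧ᴵ ψ) ⇔ᴵ (¬ᴵ φ ∨ᴵ ¬ᴵ ψ))
  dm3 : ∀ φ ψ → AxIDM4 (¬ᴵ (φ ⇒ᴵ ψ) ⇔ᴵ (φ ∧ᴵ ¬ᴵ ψ))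
  axP : ∀ φ ψ → AxIDM4 (φ ∨ᴵ (φ ⇒ᴵ ψ))

data _⊢IDM4_ (Γ : Pred FormI 0ℓ) : FormI → Set where
  premise : ∀ {φ} → Γ φ → Γ ⊢IDM4 φ
  axiom   : ∀ {φ} → AxIDM4 φ → Γ ⊢IDM4 φ
  mp      : ∀ {φ ψ} → Γ ⊢IDM4 φ → Γ ⊢IDM4 (φ ⇒ᴵ ψ) → Γ ⊢IDM4 ψ

infixr 5 _⇒ᵀ_

data FormT : Set where
  varᵀ  : ℕ → FormT
  _⇒ᵀ_  : FormT → FormT → FormT
  ∼ᵀ    : FormT → FormT
  □ᵀ    : FormT → FormT

_∨ᵀ_ : FormT → FormT → FormT
φ ∨ᵀ ψ = ∼ᵀ φ ⇒ᵀ ψ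

_∧ᵀ_ : FormT → FormT → FormT
φ ∧ᵀ ψ = ∼ᵀ (φ ⇒ᵀ ∼ᵀ ψ)

_⇔ᵀ_ : FormT → FormT → FormT
φ ⇔ᵀ ψ = ∼ᵀ ((φ ⇒ᵀ ψ) ⇒ᵀ ∼ᵀ (ψ ⇒ᵀ φ))

data AxTm : FormT → Set where
  ax1 : ∀ φ ψ → AxTm (φ ⇒ᵀ (ψ ⇒ᵀ φ))
  ax2 : ∀ φ ψ γ → AxTm ((φ ⇒ᵀ (ψ ⇒ᵀ γ)) ⇒ᵀ ((φ ⇒ᵀ ψ) ⇒ᵀ (φ ⇒ᵀ γ)))
  ax9 : ∀ φ ψ → AxTm ((∼ᵀ ψ ⇒ᵀ ∼ᵀ φ) ⇒ᵀ ((∼ᵀ ψ ⇒ᵀ φ) ⇒ᵀ ψ))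
  k   : ∀ φ ψ → AxTm (□ᵀ (φ ⇒ᵀ ψ) ⇒ᵀ (□ᵀ φ ⇒ᵀ □ᵀ ψ))
  k1  : ∀ φ ψ → AxTm (□ᵀ (φ ⇒ᵀ ψ) ⇒ᵀ (□ᵀ (∼ᵀ ψ) ⇒ᵀ □ᵀ (∼ᵀ φ)))
  k2  : ∀ φ ψ → AxTm (□ᵀ (∼ᵀ (φ ⇒ᵀ ψ)) ⇔ᵀ (□ᵀ φ ∧ᵀ □ᵀ (∼ᵀ ψ)))
  m1  : ∀ φ ψ → AxTm ((□ᵀ (∼ᵀ φ) ∨ᵀ □ᵀ ψ) ⇒ᵀ □ᵀ (φ ⇒ᵀ ψ))
  t   : ∀ φ → AxTm (□ᵀ φ ⇒ᵀ φ)
  dn1 : ∀ φ → AxTm (□ᵀ φ ⇔ᵀ □ᵀ (∼ᵀ (∼ᵀ φ)))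

data _⊢Tm_ (Γ : Pred FormT 0ℓ) : FormT → Set where
  premise : ∀ {φ} → Γ φ → Γ ⊢Tm φ
  axiom   : ∀ {φ} → AxTm φ → Γ ⊢Tm φ
  mp      : ∀ {φ ψ} → Γ ⊢Tm φ → Γ ⊢Tm (φ ⇒ᵀ ψ) → Γ ⊢Tm ψ

infixr 5 _⇒_
infixl 6 _∨_
infixl 7 _∧_

data Form : Set where
  var  : ℕ → Form
  _∧_  : Form → Form → Form
  _∨_  : Form → Form → Form
  _⇒_  : Form → Form → Form
  ¬    : Form → Form
  ∼    : Form → Form
  □    : Form → Form

_⇔ᶠ_ : Form → Form → Form
φ ⇔ᶠ ψ = (φ ⇒ ψ) ∧ (ψ ⇒ φ)

data AxIvFDET : Form → Set where
  ax1 : ∀ φ ψ → AxIvFDET (φ ⇒ (ψ ⇒ φ))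
  ax2 : ∀ φ ψ γ → AxIvFDET ((φ ⇒ (ψ ⇒ γ)) ⇒ ((φ ⇒ ψ) ⇒ (φ ⇒ γ)))
  ax3 : ∀ φ ψ → AxIvFDET (φ ⇒ (ψ ⇒ (φ ∧ ψ)))
  ax4 : ∀ φ ψ → AxIvFDET ((φ ∧ ψ) ⇒ φ)
  ax5 : ∀ φ ψ → AxIvFDET ((φ ∧ ψ) ⇒ ψ)
  ax6 : ∀ φ ψ → AxIvFDET (φ ⇒ (φ ∨ ψ))
  ax7 : ∀ φ ψ → AxIvFDET (ψ ⇒ (φ ∨ ψ))
  ax8 : ∀ φ ψ γ → AxIvFDET ((φ ⇒ γ) ⇒ ((ψ ⇒ γ) ⇒ ((φ ∨ ψ) ⇒ γ)))
  dn  : ∀ φ → AxIvFDET (¬ (¬ φ) ⇔ᶠ φ)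
  dm1 : ∀ φ ψ → AxIvFDET (¬ (φ ∨ ψ) ⇔ᶠ (¬ φ ∧ ¬ ψ))
  dm2 : ∀ φ ψ → AxIvFDET (¬ (φ ∧ ψ) ⇔ᶠ (¬ φ ∨ ¬ ψ))
  dm3 : ∀ φ ψ → AxIvFDET (¬ (φ ⇒ ψ) ⇔ᶠ (φ ∧ ¬ ψ))
  axP : ∀ φ ψ → AxIvFDET (φ ∨ (φ ⇒ ψ))
  -- axioms of Tm (∧, ∨ primitive; (Ax1), (Ax2) already listed)
  ax9 : ∀ φ ψ → AxIvFDET ((∼ ψ ⇒ ∼ φ) ⇒ ((∼ ψ ⇒ φ) ⇒ ψ))
  k   : ∀ φ ψ → AxIvFDET (□ (φ ⇒ ψ) ⇒ (□ φ ⇒ □ ψ))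
  k1  : ∀ φ ψ → AxIvFDET (□ (φ ⇒ ψ) ⇒ (□ (∼ ψ) ⇒ □ (∼ φ)))
  k2  : ∀ φ ψ → AxIvFDET (□ (∼ (φ ⇒ ψ)) ⇔ᶠ (□ φ ∧ □ (∼ ψ)))
  m1  : ∀ φ ψ → AxIvFDET ((□ (∼ φ) ∨ □ ψ) ⇒ □ (φ ⇒ ψ))
  t   : ∀ φ → AxIvFDET (□ φ ⇒ φ)
  dn1 : ∀ φ → AxIvFDET (□ φ ⇔ᶠ □ (∼ (∼ φ)))
  n1  : ∀ φ ψ → AxIvFDET (□ (φ ∧ ψ) ⇔ᶠ (□ φ ∧ □ ψ))
  n2  : ∀ φ ψ → AxIvFDET (□ (∼ (φ ∨ ψ)) ⇔ᶠ □ (∼ φ ∧ ∼ ψ))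
  n3  : ∀ φ ψ → AxIvFDET ((□ (∼ φ) ∨ □ (∼ ψ)) ⇒ □ (∼ (φ ∧ ψ)))
  n4  : ∀ φ ψ → AxIvFDET ((□ φ ∨ □ ψ) ⇒ □ (φ ∨ ψ))
  n5  : ∀ φ → AxIvFDET (□ φ ⇔ᶠ □ (∼ (¬ φ)))
  n6  : ∀ φ → AxIvFDET (□ (∼ φ) ⇔ᶠ □ (∼ (¬ (¬ φ))))
  n7  : ∀ φ ψ → AxIvFDET (□ (∼ (φ ∧ ψ)) ⇒ (□ φ ⇒ □ (∼ ψ)))
  n8  : ∀ φ ψ → AxIvFDET (□ (∼ (φ ∧ ψ)) ⇒ (□ ψ ⇒ □ (∼ φ)))
  n9  : ∀ φ ψ → AxIvFDET (□ (φ ∨ ψ) ⇒ (□ (∼ φ) ⇒ □ ψ))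
  n10 : ∀ φ ψ → AxIvFDET (□ (φ ∨ ψ) ⇒ (□ (∼ ψ) ⇒ □ φ))

data _⊢IvFDET_ (Γ : Pred Form 0ℓ) : Form → Set where
  premise : ∀ {φ} → Γ φ → Γ ⊢IvFDET φ
  axiom   : ∀ {φ} → AxIvFDET φ → Γ ⊢IvFDET φ
  mp      : ∀ {φ ψ} → Γ ⊢IvFDET φ → Γ ⊢IvFDET (φ ⇒ ψ) → Γ ⊢IvFDET ψ

embI : FormI → Form
embI (varᴵ n) = var n
embI (φ ∧ᴵ ψ) = embI φ ∧ embI ψ
embI (φ ∨ᴵ ψ) = embI φ ∨ embI ψ
embI (φ ⇒ᴵ ψ) = embI φ ⇒ embI ψ
embI (¬ᴵ φ)   = ¬ (embI φ)

embT : FormT → Form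
embT (varᵀ n) = var n
embT (φ ⇒ᵀ ψ) = embT φ ⇒ embT ψ
embT (∼ᵀ φ)   = ∼ (embT φ)
embT (□ᵀ φ)   = □ (embT φ)

image : {A : Set} → (A → Form) → Pred A 0ℓ → Pred Form 0ℓ
image f Γ χ = Σ _ (λ ψ → Γ ψ × f ψ ≡ χ)

module Submission where

open import Defs
open import Data.Product using (_×_; _,_)
open import Relation.Unary using (Pred)
open import Level using (0ℓ)
open import Function.Bundles using (_⇔_; mk⇔)
open import Relation.Binary.PropositionalEquality using (_≡_; refl; subst; sym; cong; cong₂)

-- The inclusions hold because each axiom of IDM4 and of Tm is derivable in IvFDE_T (for Tm,
-- with ∧ and ∨ read through the classical negation ∼).  Conversely, derivations are translated
-- back.  Over Tm, read ∧, ∨ and ¬ through ∼; every IvFDE_T axiom then becomes a Tm theorem.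
-- Over IDM4, fix a formula θ and read □A as θ and ∼A as A → θ.  The images of (Ax9) and (T)
-- are not IDM4 theorems, but every image holds under the continuation (· → θ) → θ thanks to
-- the Peirce-like axiom (AxP), and the continuation is compatible with modus ponens.  Taking
-- θ to be the conclusion φ, which the translation fixes, (φ → φ) → φ yields φ itself.

module Hilbert {F : Set} (imp : F → F → F) (Ax : F → Set)
  (axK : ∀ φ ψ → Ax (imp φ (imp ψ φ)))
  (axS : ∀ φ ψ γ → Ax (imp (imp φ (imp ψ γ)) (imp (imp φ ψ) (imp φ γ)))) where

  infixr 6 _⇛_
  _⇛_ : F → F → F
  _⇛_ = imp

  infixl 5 _▸_
  infix 3 _⊢_

  data _▸_ (Γ : Pred F 0ℓ) (A : F) : Pred F 0ℓ where
    old : ∀ {B} → Γ B → (Γ ▸ A) B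
    new : (Γ ▸ A) A

  data _⊢_ (Γ : Pred F 0ℓ) : F → Set where
    hyp : ∀ {φ} → Γ φ → Γ ⊢ φ
    ax  : ∀ {φ} → Ax φ → Γ ⊢ φ
    mp  : ∀ {φ ψ} → Γ ⊢ φ → Γ ⊢ φ ⇛ ψ → Γ ⊢ ψ

  weaken : ∀ {Γ Δ φ} → (∀ {B} → Γ B → Δ B) → Γ ⊢ φ → Δ ⊢ φ
  weaken f (hyp g) = hyp (f g)
  weaken f (ax a)  = ax a
  weaken f (mp d e) = mp (weaken f d) (weaken f e)

  wk : ∀ {Γ A φ} → Γ ⊢ φ → Γ ▸ A ⊢ φ
  wk = weaken old

  #0 : ∀ {Γ A} → Γ ▸ A ⊢ A
  #0 = hyp new

  #1 : ∀ {Γ A B} → Γ ▸ A ▸ B ⊢ A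
  #1 = wk #0

  #2 : ∀ {Γ A B C} → Γ ▸ A ▸ B ▸ C ⊢ A
  #2 = wk #1

  #3 : ∀ {Γ A B C D} → Γ ▸ A ▸ B ▸ C ▸ D ⊢ A
  #3 = wk #2

  ⇛-refl : ∀ {Γ} A → Γ ⊢ A ⇛ A
  ⇛-refl A = mp (ax (axK A A)) (mp (ax (axK A (A ⇛ A))) (ax (axS A (A ⇛ A) A)))

  deduction : ∀ {Γ A B} → Γ ▸ A ⊢ B → Γ ⊢ A ⇛ B
  deduction {A = A} (hyp (old g)) = mp (hyp g) (ax (axK _ A))
  deduction {A = A} (hyp new)     = ⇛-refl A
  deduction {A = A} (ax a)        = mp (ax a) (ax (axK _ A))
  deduction {A = A} {B} (mp {φ} d e) =
    mp (deduction d) (mp (deduction e) (ax (axS A φ B)))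

module Classical {F : Set} (imp : F → F → F) (neg : F → F) (Ax : F → Set)
  (axK : ∀ φ ψ → Ax (imp φ (imp ψ φ)))
  (axS : ∀ φ ψ γ → Ax (imp (imp φ (imp ψ γ)) (imp (imp φ ψ) (imp φ γ))))
  (axRAA : ∀ φ ψ → Ax (imp (imp (neg ψ) (neg φ)) (imp (imp (neg ψ) φ) ψ))) where

  open Hilbert imp Ax axK axS public

  infix 8 ~_
  ~_ : F → F
  ~_ = neg

  _∧ᶜ_ : F → F → F
  A ∧ᶜ B = ~ (A ⇛ ~ B)

  _∨ᶜ_ : F → F → F
  A ∨ᶜ B = ~ A ⇛ B

  _⇔ᶜ_ : F → F → F
  A ⇔ᶜ B = (A ⇛ B) ∧ᶜ (B ⇛ A)

  by-contradiction : ∀ {Γ A B} → Γ ▸ ~ A ⊢ B → Γ ▸ ~ A ⊢ ~ B → Γ ⊢ A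
  by-contradiction {A = A} {B} d e = mp (deduction d) (mp (deduction e) (ax (axRAA B A)))

  explosion : ∀ {Γ A B} → Γ ⊢ A → Γ ⊢ ~ A → Γ ⊢ B
  explosion a na = by-contradiction (wk a) (wk na)

  ~~-elim : ∀ {Γ A} → Γ ⊢ ~ (~ A) → Γ ⊢ A
  ~~-elim d = by-contradiction #0 (wk d)

  ~~-intro : ∀ {Γ A} → Γ ⊢ A → Γ ⊢ ~ (~ A)
  ~~-intro a = by-contradiction (wk a) (~~-elim #0)

  ~⇛-intro : ∀ {Γ A B} → Γ ⊢ A → Γ ⊢ ~ B → Γ ⊢ ~ (A ⇛ B)
  ~⇛-intro a nb = by-contradiction (mp (wk a) (~~-elim #0)) (wk nb)

  ~⇛-elimˡ : ∀ {Γ A B} → Γ ⊢ ~ (A ⇛ B) → Γ ⊢ A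
  ~⇛-elimˡ d = by-contradiction (deduction (explosion #0 #1)) (wk d)

  ~⇛-elimʳ : ∀ {Γ A B} → Γ ⊢ ~ (A ⇛ B) → Γ ⊢ ~ B
  ~⇛-elimʳ d = by-contradiction (deduction (~~-elim #1)) (wk d)

  contraposition : ∀ {Γ A B} → Γ ⊢ A ⇛ B → Γ ⊢ ~ B → Γ ⊢ ~ A
  contraposition f nb = by-contradiction (mp (~~-elim #0) (wk f)) (wk nb)

  by-cases : ∀ {Γ A C} → Γ ▸ A ⊢ C → Γ ▸ ~ A ⊢ C → Γ ⊢ C
  by-cases d e =
    by-contradiction (mp (by-contradiction (mp (~~-elim #0) (wk (wk (deduction d)))) #1)
                         (wk (deduction e)))
                     #0

  ∧ᶜ-intro : ∀ {Γ A B} → Γ ⊢ A → Γ ⊢ B → Γ ⊢ A ∧ᶜ B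
  ∧ᶜ-intro a b = ~⇛-intro a (~~-intro b)

  ∧ᶜ-elimˡ : ∀ {Γ A B} → Γ ⊢ A ∧ᶜ B → Γ ⊢ A
  ∧ᶜ-elimˡ = ~⇛-elimˡ

  ∧ᶜ-elimʳ : ∀ {Γ A B} → Γ ⊢ A ∧ᶜ B → Γ ⊢ B
  ∧ᶜ-elimʳ d = ~~-elim (~⇛-elimʳ d)

  ⇔ᶜ-intro : ∀ {Γ A B} → Γ ▸ A ⊢ B → Γ ▸ B ⊢ A → Γ ⊢ A ⇔ᶜ B
  ⇔ᶜ-intro d e = ∧ᶜ-intro (deduction d) (deduction e)

  ⇔ᶜ-elimˡ : ∀ {Γ A B} → Γ ⊢ A ⇔ᶜ B → Γ ⊢ A → Γ ⊢ B
  ⇔ᶜ-elimˡ d a = mp a (∧ᶜ-elimˡ d)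

  ⇔ᶜ-elimʳ : ∀ {Γ A B} → Γ ⊢ A ⇔ᶜ B → Γ ⊢ B → Γ ⊢ A
  ⇔ᶜ-elimʳ d b = mp b (∧ᶜ-elimʳ d)

embI-axiom : ∀ {Δ φ} → AxIDM4 φ → Δ ⊢IvFDET embI φ
embI-axiom (AxIDM4.ax1 φ ψ)   = axiom (AxIvFDET.ax1 _ _)
embI-axiom (AxIDM4.ax2 φ ψ γ) = axiom (AxIvFDET.ax2 _ _ _)
embI-axiom (AxIDM4.ax3 φ ψ)   = axiom (AxIvFDET.ax3 _ _)
embI-axiom (AxIDM4.ax4 φ ψ)   = axiom (AxIvFDET.ax4 _ _)
embI-axiom (AxIDM4.ax5 φ ψ)   = axiom (AxIvFDET.ax5 _ _)
embI-axiom (AxIDM4.ax6 φ ψ)   = axiom (AxIvFDET.ax6 _ _)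
embI-axiom (AxIDM4.ax7 φ ψ)   = axiom (AxIvFDET.ax7 _ _)
embI-axiom (AxIDM4.ax8 φ ψ γ) = axiom (AxIvFDET.ax8 _ _ _)
embI-axiom (AxIDM4.dn φ)      = axiom (AxIvFDET.dn _)
embI-axiom (AxIDM4.dm1 φ ψ)   = axiom (AxIvFDET.dm1 _ _)
embI-axiom (AxIDM4.dm2 φ ψ)   = axiom (AxIvFDET.dm2 _ _)
embI-axiom (AxIDM4.dm3 φ ψ)   = axiom (AxIvFDET.dm3 _ _)
embI-axiom (AxIDM4.axP φ ψ)   = axiom (AxIvFDET.axP _ _)

embI-sound : ∀ {Γ φ} → Γ ⊢IDM4 φ → image embI Γ ⊢IvFDET embI φ
embI-sound (premise {φ} g) = premise (φ , g , refl)
embI-sound (axiom a)       = embI-axiom a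
embI-sound (mp d e)        = mp (embI-sound d) (embI-sound e)

module IvFDETᶜ where
  open Classical _⇒_ ∼ AxIvFDET AxIvFDET.ax1 AxIvFDET.ax2 AxIvFDET.ax9 public

  toIvFDET : ∀ {Γ φ} → Γ ⊢ φ → Γ ⊢IvFDET φ
  toIvFDET (hyp g)  = premise g
  toIvFDET (ax a)   = axiom a
  toIvFDET (mp d e) = mp (toIvFDET d) (toIvFDET e)

  ∧-intro : ∀ {Γ A B} → Γ ⊢ A → Γ ⊢ B → Γ ⊢ A ∧ B
  ∧-intro a b = mp b (mp a (ax (AxIvFDET.ax3 _ _)))

  ∧-elimˡ : ∀ {Γ A B} → Γ ⊢ A ∧ B → Γ ⊢ A
  ∧-elimˡ d = mp d (ax (AxIvFDET.ax4 _ _))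

  ∧-elimʳ : ∀ {Γ A B} → Γ ⊢ A ∧ B → Γ ⊢ B
  ∧-elimʳ d = mp d (ax (AxIvFDET.ax5 _ _))

  ∧⇒∧ᶜ : ∀ {Γ A B} → Γ ⊢ A ∧ B → Γ ⊢ A ∧ᶜ B
  ∧⇒∧ᶜ d = ∧ᶜ-intro (∧-elimˡ d) (∧-elimʳ d)

  ∧ᶜ⇒∧ : ∀ {Γ A B} → Γ ⊢ A ∧ᶜ B → Γ ⊢ A ∧ B
  ∧ᶜ⇒∧ d = ∧-intro (∧ᶜ-elimˡ d) (∧ᶜ-elimʳ d)

  ∨ᶜ⇒∨ : ∀ {Γ A B} → Γ ⊢ A ∨ᶜ B → Γ ⊢ A ∨ B
  ∨ᶜ⇒∨ d = by-cases (mp #0 (ax (AxIvFDET.ax6 _ _)))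
                    (mp (mp #0 (wk d)) (ax (AxIvFDET.ax7 _ _)))

  embT-axiom : ∀ {Γ φ} → AxTm φ → Γ ⊢ embT φ
  embT-axiom (AxTm.ax1 φ ψ)   = ax (AxIvFDET.ax1 _ _)
  embT-axiom (AxTm.ax2 φ ψ γ) = ax (AxIvFDET.ax2 _ _ _)
  embT-axiom (AxTm.ax9 φ ψ)   = ax (AxIvFDET.ax9 _ _)
  embT-axiom (AxTm.k φ ψ)     = ax (AxIvFDET.k _ _)
  embT-axiom (AxTm.k1 φ ψ)    = ax (AxIvFDET.k1 _ _)
  embT-axiom (AxTm.k2 φ ψ)    =
    ⇔ᶜ-intro (∧⇒∧ᶜ (mp #0 (∧-elimˡ (ax (AxIvFDET.k2 _ _)))))
             (mp (∧ᶜ⇒∧ #0) (∧-elimʳ (ax (AxIvFDET.k2 _ _))))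
  embT-axiom (AxTm.m1 φ ψ)    = deduction (mp (∨ᶜ⇒∨ #0) (ax (AxIvFDET.m1 _ _)))
  embT-axiom (AxTm.t φ)       = ax (AxIvFDET.t _)
  embT-axiom (AxTm.dn1 φ)     = ∧⇒∧ᶜ (ax (AxIvFDET.dn1 _))

  embT-derivation : ∀ {Γ φ} → Γ ⊢Tm φ → image embT Γ ⊢ embT φ
  embT-derivation (premise {φ} g) = hyp (φ , g , refl)
  embT-derivation (axiom a)       = embT-axiom a
  embT-derivation (mp d e)        = mp (embT-derivation d) (embT-derivation e)

embT-sound : ∀ {Γ φ} → Γ ⊢Tm φ → image embT Γ ⊢IvFDET embT φ
embT-sound d = toIvFDET (embT-derivation d)
  where open IvFDETᶜ

transᵀ : Form → FormT
transᵀ (var n) = varᵀ n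
transᵀ (a ∧ b) = transᵀ a ∧ᵀ transᵀ b
transᵀ (a ∨ b) = transᵀ a ∨ᵀ transᵀ b
transᵀ (a ⇒ b) = transᵀ a ⇒ᵀ transᵀ b
transᵀ (¬ a)   = ∼ᵀ (transᵀ a)
transᵀ (∼ a)   = ∼ᵀ (transᵀ a)
transᵀ (□ a)   = □ᵀ (transᵀ a)

transᵀ-embT : ∀ φ → transᵀ (embT φ) ≡ φ
transᵀ-embT (varᵀ n) = refl
transᵀ-embT (φ ⇒ᵀ ψ) = cong₂ _⇒ᵀ_ (transᵀ-embT φ) (transᵀ-embT ψ)
transᵀ-embT (∼ᵀ φ)   = cong ∼ᵀ (transᵀ-embT φ)
transᵀ-embT (□ᵀ φ)   = cong □ᵀ (transᵀ-embT φ)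

module Tmᶜ where
  open Classical _⇒ᵀ_ ∼ᵀ AxTm AxTm.ax1 AxTm.ax2 AxTm.ax9 public

  toTm : ∀ {Γ φ} → Γ ⊢ φ → Γ ⊢Tm φ
  toTm (hyp g)  = premise g
  toTm (ax a)   = axiom a
  toTm (mp d e) = mp (toTm d) (toTm e)

  □∼∼-intro : ∀ {Γ A} → Γ ⊢ □ᵀ A → Γ ⊢ □ᵀ (∼ᵀ (∼ᵀ A))
  □∼∼-intro = ⇔ᶜ-elimˡ (ax (AxTm.dn1 _))

  □∼∼-elim : ∀ {Γ A} → Γ ⊢ □ᵀ (∼ᵀ (∼ᵀ A)) → Γ ⊢ □ᵀ A
  □∼∼-elim = ⇔ᶜ-elimʳ (ax (AxTm.dn1 _))

  □∼⇒-intro : ∀ {Γ A B} → Γ ⊢ □ᵀ A → Γ ⊢ □ᵀ (∼ᵀ B) → Γ ⊢ □ᵀ (∼ᵀ (A ⇒ᵀ B))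
  □∼⇒-intro a nb = ⇔ᶜ-elimʳ (ax (AxTm.k2 _ _)) (∧ᶜ-intro a nb)

  □∼⇒-elimˡ : ∀ {Γ A B} → Γ ⊢ □ᵀ (∼ᵀ (A ⇒ᵀ B)) → Γ ⊢ □ᵀ A
  □∼⇒-elimˡ d = ∧ᶜ-elimˡ (⇔ᶜ-elimˡ (ax (AxTm.k2 _ _)) d)

  □∼⇒-elimʳ : ∀ {Γ A B} → Γ ⊢ □ᵀ (∼ᵀ (A ⇒ᵀ B)) → Γ ⊢ □ᵀ (∼ᵀ B)
  □∼⇒-elimʳ d = ∧ᶜ-elimʳ (⇔ᶜ-elimˡ (ax (AxTm.k2 _ _)) d)

  transᵀ-axiom : ∀ {Γ χ} → AxIvFDET χ → Γ ⊢ transᵀ χ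
  transᵀ-axiom (AxIvFDET.ax1 φ ψ)   = ax (AxTm.ax1 _ _)
  transᵀ-axiom (AxIvFDET.ax2 φ ψ γ) = ax (AxTm.ax2 _ _ _)
  transᵀ-axiom (AxIvFDET.ax3 φ ψ)   = deduction (deduction (∧ᶜ-intro #1 #0))
  transᵀ-axiom (AxIvFDET.ax4 φ ψ)   = deduction (∧ᶜ-elimˡ #0)
  transᵀ-axiom (AxIvFDET.ax5 φ ψ)   = deduction (∧ᶜ-elimʳ #0)
  transᵀ-axiom (AxIvFDET.ax6 φ ψ)   = deduction (deduction (explosion #1 #0))
  transᵀ-axiom (AxIvFDET.ax7 φ ψ)   = ax (AxTm.ax1 _ _)
  transᵀ-axiom (AxIvFDET.ax8 φ ψ γ) =
    deduction (deduction (deduction (by-cases (mp #0 #3) (mp (mp #0 #1) #2))))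
  transᵀ-axiom (AxIvFDET.dn φ)      = ⇔ᶜ-intro (~~-elim #0) (~~-intro #0)
  transᵀ-axiom (AxIvFDET.dm1 φ ψ)   =
    ⇔ᶜ-intro (~⇛-intro (~⇛-elimˡ #0) (~~-intro (~⇛-elimʳ #0)))
             (~⇛-intro (~⇛-elimˡ #0) (~~-elim (~⇛-elimʳ #0)))
  transᵀ-axiom (AxIvFDET.dm2 φ ψ)   =
    ⇔ᶜ-intro (deduction (mp (~~-elim #0) (~~-elim #1)))
             (~~-intro (deduction (mp (~~-intro #0) #1)))
  transᵀ-axiom (AxIvFDET.dm3 φ ψ)   =
    ⇔ᶜ-intro (~⇛-intro (~⇛-elimˡ #0) (~~-intro (~⇛-elimʳ #0)))
             (~⇛-intro (~⇛-elimˡ #0) (~~-elim (~⇛-elimʳ #0)))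
  transᵀ-axiom (AxIvFDET.axP φ ψ)   = deduction (deduction (explosion #0 #1))
  transᵀ-axiom (AxIvFDET.ax9 φ ψ)   = ax (AxTm.ax9 _ _)
  transᵀ-axiom (AxIvFDET.k φ ψ)     = ax (AxTm.k _ _)
  transᵀ-axiom (AxIvFDET.k1 φ ψ)    = ax (AxTm.k1 _ _)
  transᵀ-axiom (AxIvFDET.k2 φ ψ)    = ax (AxTm.k2 _ _)
  transᵀ-axiom (AxIvFDET.m1 φ ψ)    = ax (AxTm.m1 _ _)
  transᵀ-axiom (AxIvFDET.t φ)       = ax (AxTm.t _)
  transᵀ-axiom (AxIvFDET.dn1 φ)     = ax (AxTm.dn1 _)
  transᵀ-axiom (AxIvFDET.n1 φ ψ)    =
    ⇔ᶜ-intro (∧ᶜ-intro (□∼⇒-elimˡ #0) (□∼∼-elim (□∼⇒-elimʳ #0)))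
             (□∼⇒-intro (∧ᶜ-elimˡ #0) (□∼∼-intro (∧ᶜ-elimʳ #0)))
  transᵀ-axiom (AxIvFDET.n2 φ ψ)    =
    ⇔ᶜ-intro (□∼⇒-intro (□∼⇒-elimˡ #0) (□∼∼-intro (□∼⇒-elimʳ #0)))
             (□∼⇒-intro (□∼⇒-elimˡ #0) (□∼∼-elim (□∼⇒-elimʳ #0)))
  transᵀ-axiom (AxIvFDET.n3 φ ψ)    = deduction (□∼∼-intro (mp #0 (ax (AxTm.m1 _ _))))
  transᵀ-axiom (AxIvFDET.n4 φ ψ)    =
    deduction (mp (deduction (mp (contraposition (deduction (□∼∼-intro #0)) #0) #1))
                  (ax (AxTm.m1 _ _)))
  transᵀ-axiom (AxIvFDET.n5 φ)      = ax (AxTm.dn1 _)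
  transᵀ-axiom (AxIvFDET.n6 φ)      = ax (AxTm.dn1 _)
  transᵀ-axiom (AxIvFDET.n7 φ ψ)    = deduction (mp (□∼∼-elim #0) (ax (AxTm.k _ _)))
  transᵀ-axiom (AxIvFDET.n8 φ ψ)    =
    deduction (deduction (mp (□∼∼-intro #0) (mp (□∼∼-elim #1) (ax (AxTm.k1 _ _)))))
  transᵀ-axiom (AxIvFDET.n9 φ ψ)    = ax (AxTm.k _ _)
  transᵀ-axiom (AxIvFDET.n10 φ ψ)   =
    deduction (deduction (□∼∼-elim (mp #0 (mp #1 (ax (AxTm.k1 _ _))))))

  transᵀ-derivation : ∀ {Γ χ} → image embT Γ ⊢IvFDET χ → Γ ⊢ transᵀ χ
  transᵀ-derivation {Γ} (premise (ψ , g , refl)) = hyp (subst Γ (sym (transᵀ-embT ψ)) g)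
  transᵀ-derivation (axiom a) = transᵀ-axiom a
  transᵀ-derivation (mp d e)  = mp (transᵀ-derivation d) (transᵀ-derivation e)

embT-conservative : ∀ {Γ φ} → image embT Γ ⊢IvFDET embT φ → Γ ⊢Tm φ
embT-conservative {Γ} {φ} d = toTm (subst (Γ ⊢_) (transᵀ-embT φ) (transᵀ-derivation d))
  where open Tmᶜ

transᴵ : FormI → Form → FormI
transᴵ θ (var n) = varᴵ n
transᴵ θ (a ∧ b) = transᴵ θ a ∧ᴵ transᴵ θ b
transᴵ θ (a ∨ b) = transᴵ θ a ∨ᴵ transᴵ θ b
transᴵ θ (a ⇒ b) = transᴵ θ a ⇒ᴵ transᴵ θ b
transᴵ θ (¬ a)   = ¬ᴵ (transᴵ θ a)
transᴵ θ (∼ a)   = transᴵ θ a ⇒ᴵ θ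
transᴵ θ (□ a)   = θ

transᴵ-embI : ∀ θ φ → transᴵ θ (embI φ) ≡ φ
transᴵ-embI θ (varᴵ n) = refl
transᴵ-embI θ (φ ∧ᴵ ψ) = cong₂ _∧ᴵ_ (transᴵ-embI θ φ) (transᴵ-embI θ ψ)
transᴵ-embI θ (φ ∨ᴵ ψ) = cong₂ _∨ᴵ_ (transᴵ-embI θ φ) (transᴵ-embI θ ψ)
transᴵ-embI θ (φ ⇒ᴵ ψ) = cong₂ _⇒ᴵ_ (transᴵ-embI θ φ) (transᴵ-embI θ ψ)
transᴵ-embI θ (¬ᴵ φ)   = cong ¬ᴵ (transᴵ-embI θ φ)

module IDM4ʰ where
  open Hilbert _⇒ᴵ_ AxIDM4 AxIDM4.ax1 AxIDM4.ax2 public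

  toIDM4 : ∀ {Γ φ} → Γ ⊢ φ → Γ ⊢IDM4 φ
  toIDM4 (hyp g)  = premise g
  toIDM4 (ax a)   = axiom a
  toIDM4 (mp d e) = mp (toIDM4 d) (toIDM4 e)

  ∧-intro : ∀ {Γ A B} → Γ ⊢ A → Γ ⊢ B → Γ ⊢ A ∧ᴵ B
  ∧-intro a b = mp b (mp a (ax (AxIDM4.ax3 _ _)))

  ∨-elim : ∀ {Γ A B C} → Γ ⊢ A ∨ᴵ B → Γ ▸ A ⊢ C → Γ ▸ B ⊢ C → Γ ⊢ C
  ∨-elim d e f = mp d (mp (deduction f) (mp (deduction e) (ax (AxIDM4.ax8 _ _ _))))

  peirce : ∀ {Γ} A B → Γ ⊢ ((A ⇒ᴵ B) ⇒ᴵ A) ⇒ᴵ A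
  peirce A B = deduction (∨-elim (ax (AxIDM4.axP A B)) #0 (mp #0 #1))

  module Continuation (θ : FormI) where

    Cont : FormI → FormI
    Cont X = (X ⇒ᴵ θ) ⇒ᴵ θ

    cont-pure : ∀ {Γ X} → Γ ⊢ X → Γ ⊢ Cont X
    cont-pure x = deduction (mp (wk x) #0)

    cont-mp : ∀ {Γ A B} → Γ ⊢ Cont A → Γ ⊢ Cont (A ⇒ᴵ B) → Γ ⊢ Cont B
    cont-mp ca cf =
      deduction (mp (deduction (mp (deduction (mp (mp #1 #0) #2)) (wk (wk cf)))) (wk ca))

    -- Split on (AxP) for B, then for θ: B or θ ends the proof outright, and from B → θ and
    -- θ → B the formula itself follows.
    cont-ax9 : ∀ {Γ} A B →
      Γ ⊢ Cont (((B ⇒ᴵ θ) ⇒ᴵ (A ⇒ᴵ θ)) ⇒ᴵ (((B ⇒ᴵ θ) ⇒ᴵ A) ⇒ᴵ B))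
    cont-ax9 A B =
      deduction (∨-elim (ax (AxIDM4.axP B θ))
                        (mp (deduction (deduction #2)) #1)
                        (∨-elim (ax (AxIDM4.axP θ B))
                                #0
                                (mp (deduction (deduction (mp (mp (mp #3 #0) (mp #3 #1)) #2))) #2)))

    θ⇔θ : ∀ {Γ} → Γ ⊢ θ ⇔ᴵ θ
    θ⇔θ = ∧-intro (⇛-refl θ) (⇛-refl θ)

    θ⇔θ∧θ : ∀ {Γ} → Γ ⊢ θ ⇔ᴵ (θ ∧ᴵ θ)
    θ⇔θ∧θ = ∧-intro (deduction (∧-intro #0 #0)) (ax (AxIDM4.ax4 _ _))

    θ∨θ⇒θ : ∀ {Γ} → Γ ⊢ θ ∨ᴵ θ ⇒ᴵ θ
    θ∨θ⇒θ = deduction (∨-elim #0 #0 #0)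

    θ⇒θ⇒θ : ∀ {Γ} → Γ ⊢ θ ⇒ᴵ θ ⇒ᴵ θ
    θ⇒θ⇒θ = ax (AxIDM4.ax1 _ _)

    transᴵ-axiom : ∀ {Γ χ} → AxIvFDET χ → Γ ⊢ Cont (transᴵ θ χ)
    transᴵ-axiom (AxIvFDET.ax1 φ ψ)   = cont-pure (ax (AxIDM4.ax1 _ _))
    transᴵ-axiom (AxIvFDET.ax2 φ ψ γ) = cont-pure (ax (AxIDM4.ax2 _ _ _))
    transᴵ-axiom (AxIvFDET.ax3 φ ψ)   = cont-pure (ax (AxIDM4.ax3 _ _))
    transᴵ-axiom (AxIvFDET.ax4 φ ψ)   = cont-pure (ax (AxIDM4.ax4 _ _))
    transᴵ-axiom (AxIvFDET.ax5 φ ψ)   = cont-pure (ax (AxIDM4.ax5 _ _))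
    transᴵ-axiom (AxIvFDET.ax6 φ ψ)   = cont-pure (ax (AxIDM4.ax6 _ _))
    transᴵ-axiom (AxIvFDET.ax7 φ ψ)   = cont-pure (ax (AxIDM4.ax7 _ _))
    transᴵ-axiom (AxIvFDET.ax8 φ ψ γ) = cont-pure (ax (AxIDM4.ax8 _ _ _))
    transᴵ-axiom (AxIvFDET.dn φ)      = cont-pure (ax (AxIDM4.dn _))
    transᴵ-axiom (AxIvFDET.dm1 φ ψ)   = cont-pure (ax (AxIDM4.dm1 _ _))
    transᴵ-axiom (AxIvFDET.dm2 φ ψ)   = cont-pure (ax (AxIDM4.dm2 _ _))
    transᴵ-axiom (AxIvFDET.dm3 φ ψ)   = cont-pure (ax (AxIDM4.dm3 _ _))
    transᴵ-axiom (AxIvFDET.axP φ ψ)   = cont-pure (ax (AxIDM4.axP _ _))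
    transᴵ-axiom (AxIvFDET.ax9 φ ψ)   = cont-ax9 _ _
    transᴵ-axiom (AxIvFDET.k φ ψ)     = cont-pure θ⇒θ⇒θ
    transᴵ-axiom (AxIvFDET.k1 φ ψ)    = cont-pure θ⇒θ⇒θ
    transᴵ-axiom (AxIvFDET.k2 φ ψ)    = cont-pure θ⇔θ∧θ
    transᴵ-axiom (AxIvFDET.m1 φ ψ)    = cont-pure θ∨θ⇒θ
    transᴵ-axiom (AxIvFDET.t φ)       = peirce _ _
    transᴵ-axiom (AxIvFDET.dn1 φ)     = cont-pure θ⇔θ
    transᴵ-axiom (AxIvFDET.n1 φ ψ)    = cont-pure θ⇔θ∧θ
    transᴵ-axiom (AxIvFDET.n2 φ ψ)    = cont-pure θ⇔θ
    transᴵ-axiom (AxIvFDET.n3 φ ψ)    = cont-pure θ∨θ⇒θ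
    transᴵ-axiom (AxIvFDET.n4 φ ψ)    = cont-pure θ∨θ⇒θ
    transᴵ-axiom (AxIvFDET.n5 φ)      = cont-pure θ⇔θ
    transᴵ-axiom (AxIvFDET.n6 φ)      = cont-pure θ⇔θ
    transᴵ-axiom (AxIvFDET.n7 φ ψ)    = cont-pure θ⇒θ⇒θ
    transᴵ-axiom (AxIvFDET.n8 φ ψ)    = cont-pure θ⇒θ⇒θ
    transᴵ-axiom (AxIvFDET.n9 φ ψ)    = cont-pure θ⇒θ⇒θ
    transᴵ-axiom (AxIvFDET.n10 φ ψ)   = cont-pure θ⇒θ⇒θ

    transᴵ-derivation : ∀ {Γ χ} → image embI Γ ⊢IvFDET χ → Γ ⊢ Cont (transᴵ θ χ)
    transᴵ-derivation {Γ} (premise (ψ , g , refl)) =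
      cont-pure (hyp (subst Γ (sym (transᴵ-embI θ ψ)) g))
    transᴵ-derivation (axiom a) = transᴵ-axiom a
    transᴵ-derivation (mp d e)  = cont-mp (transᴵ-derivation d) (transᴵ-derivation e)

embI-conservative : ∀ {Γ φ} → image embI Γ ⊢IvFDET embI φ → Γ ⊢IDM4 φ
embI-conservative {Γ} {φ} d =
  toIDM4 (mp (⇛-refl φ) (subst (λ X → Γ ⊢ Cont X) (transᴵ-embI φ φ) (transᴵ-derivation d)))
  where
    open IDM4ʰ
    open Continuation φ

mainTheorem3 : ((Γ : Pred FormI 0ℓ) (φ : FormI) → (image embI Γ ⊢IvFDET embI φ) ⇔ (Γ ⊢IDM4 φ))
    × ((Γ : Pred FormT 0ℓ) (φ : FormT) → (image embT Γ ⊢IvFDET embT φ) ⇔ (Γ ⊢Tm φ))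
mainTheorem3 = (λ Γ φ → mk⇔ embI-conservative embI-sound)
             , (λ Γ φ → mk⇔ embT-conservative embT-sound)
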